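{- Let $G$ be a graph, $\mathcal{P}$ a maximal $P_2$-packing of $G$ of size $j$, suppose $G$ has a $P_2$-packing of size $j+1$, and let $\mathcal{Q}\in\mathfrak{Q}_{(2)}$. For every $p\in\mathcal{P}$ with $|V(p)\cap V(\mathcal{Q})|=2$, at least one of the two vertices of $V(p)\cap V(\mathcal{Q})$ is a $\mathcal{Q}$-endpoint.
   Context: A $P_2$ is a path $q=q_1q_2q_3$ with three vertices and two edges. A $P_2$-packing is a set of pairwise vertex-disjoint $P_2$'s in $G$, maximal if no further $P_2$ vertex-disjoint from all members can be added. $V(\cdot)$, $E(\cdot)$ denote vertex/edge sets (unions for sets of paths). $\mathfrak{Q}_{(1)}$ is the set of $P_2$-packings $\mathcal{Q}$ of size $j+1$ maximizing $\sum_{p\in\mathcal{P}}\sum_{q\in\mathcal{Q}}1_{[E(p)=E(q)]}$; $\mathfrak{Q}_{(2)}$ is the set of those $\mathcal{Q}\in\mathfrak{Q}_{(1)}$ maximizing $\sum_{p\in\mathcal{P}}\sum_{q\in\mathcal{Q}}|E(p)\cap E(q)|$. A vertex $v$ is a $\mathcal{Q}$-endpoint if there is a (unique) $q=q_1q_2q_3\in\mathcal{Q}$ with $v=q_1$ or $v=q_3$. -}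

module Defs where

open import Data.Nat using (ℕ; suc; _≤_)
open import Data.Bool using (Bool; true; false; _∧_; _∨_; if_then_else_)
open import Data.Fin using (Fin)
open import Data.Fin.Properties using (_≟_)
open import Data.List using (List; []; _∷_; length; map)
open import Data.Bool.ListAction using (any; all)
open import Data.Nat.ListAction using (sum)
open import Data.List.Membership.Propositional using (_∈_)
open import Data.List.Relation.Unary.All using (All)
open import Data.List.Relation.Unary.AllPairs using (AllPairs)
open import Data.Product using (_×_; _,_; ∃-syntax)
open import Data.Sum using (_⊎_)
open import Relation.Nullary using (¬_)
open import Relation.Nullary.Decidable using (⌊_⌋)
open import Relation.Binary.PropositionalEquality using (_≡_)

record Graph : Set₁ where
  field
    n      : ℕ
    Adj    : Fin n → Fin n → Set
    sym    : ∀ {u v} → Adj u v → Adj v u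
    irrefl : ∀ {v} → ¬ Adj v v

Vertex : Graph → Set
Vertex G = Fin (Graph.n G)

record Triple (G : Graph) : Set where
  constructor ⟨_,_,_⟩
  field
    q1 q2 q3 : Vertex G
open Triple public

IsP2 : (G : Graph) → Triple G → Set
IsP2 G q = ¬ (q1 q ≡ q2 q) × ¬ (q2 q ≡ q3 q) × ¬ (q1 q ≡ q3 q)
         × Graph.Adj G (q1 q) (q2 q) × Graph.Adj G (q2 q) (q3 q)

_∈V_ : {G : Graph} → Vertex G → Triple G → Set
v ∈V q = v ≡ q1 q ⊎ v ≡ q2 q ⊎ v ≡ q3 q

Disjoint : {G : Graph} → Triple G → Triple G → Set
Disjoint p q = ∀ v → v ∈V p → ¬ (v ∈V q)

IsPacking : (G : Graph) → List (Triple G) → Set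
IsPacking G Q = All (IsP2 G) Q × AllPairs Disjoint Q

IsMaximalPacking : (G : Graph) → List (Triple G) → Set
IsMaximalPacking G P =
  IsPacking G P × (∀ q → IsP2 G q → ¬ (∀ p → p ∈ P → Disjoint q p))

_∈Vs_ : {G : Graph} → Vertex G → List (Triple G) → Set
v ∈Vs Q = ∃[ q ] (q ∈ Q × v ∈V q)

IsEndpoint : {G : Graph} → List (Triple G) → Vertex G → Set
IsEndpoint Q v = ∃[ q ] (q ∈ Q × (v ≡ q1 q ⊎ v ≡ q3 q))

-- an (unordered) edge, given by its two endpoints
Edge : Graph → Set
Edge G = Vertex G × Vertex G

sameEdge : {G : Graph} → Edge G → Edge G → Bool
sameEdge (a , b) (c , d) =
  (⌊ a ≟ c ⌋ ∧ ⌊ b ≟ d ⌋) ∨ (⌊ a ≟ d ⌋ ∧ ⌊ b ≟ c ⌋)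

edges : {G : Graph} → Triple G → List (Edge G)
edges q = (q1 q , q2 q) ∷ (q2 q , q3 q) ∷ []

edgeIn : {G : Graph} → Edge G → Triple G → Bool
edgeIn {G} e q = any (sameEdge {G} e) (edges q)

indicator : Bool → ℕ
indicator b = if b then 1 else 0

sameEdgeSet : {G : Graph} → Triple G → Triple G → Bool
sameEdgeSet p q = all (λ e → edgeIn e q) (edges p) ∧ all (λ e → edgeIn e p) (edges q)

-- |E(p) ∩ E(q)|   (the edges of p are distinct since p1 ≠ p3)
commonEdges : {G : Graph} → Triple G → Triple G → ℕ
commonEdges p q = sum (map (λ e → indicator (edgeIn e q)) (edges p))

score₁ : {G : Graph} → List (Triple G) → List (Triple G) → ℕ
score₁ P Q = sum (map (λ p → sum (map (λ q → indicator (sameEdgeSet p q)) Q)) P)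

score₂ : {G : Graph} → List (Triple G) → List (Triple G) → ℕ
score₂ P Q = sum (map (λ p → sum (map (λ q → commonEdges p q) Q)) P)

In𝔔₁ : (G : Graph) → List (Triple G) → ℕ → List (Triple G) → Set
In𝔔₁ G P j Q =
  IsPacking G Q × length Q ≡ suc j ×
  (∀ Q' → IsPacking G Q' → length Q' ≡ suc j → score₁ P Q' ≤ score₁ P Q)

In𝔔₂ : (G : Graph) → List (Triple G) → ℕ → List (Triple G) → Set
In𝔔₂ G P j Q =
  In𝔔₁ G P j Q × (∀ Q' → In𝔔₁ G P j Q' → score₂ P Q' ≤ score₂ P Q)

inVs? : {G : Graph} → Vertex G → List (Triple G) → Bool
inVs? v Q = any (λ q → ⌊ v ≟ q1 q ⌋ ∨ ⌊ v ≟ q2 q ⌋ ∨ ⌊ v ≟ q3 q ⌋) Q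

-- |V(p) ∩ V(𝒬)|   (the vertices of p are distinct)
sharedVertices : {G : Graph} → Triple G → List (Triple G) → ℕ
sharedVertices p Q = sum (map (λ v → indicator (inVs? v Q)) (q1 p ∷ q2 p ∷ q3 p ∷ []))

-- Suppose no vertex of p is a 𝒬-endpoint.  One
-- vertex w of p lies outside V(𝒬), and a neighbour x of w on p lies in V(𝒬);
-- not being an endpoint, x is the centre of some q = q₁xq₃ ∈ 𝒬.  Swinging q
-- onto w (replacing it by q₁xw) gives again a P₂-packing of size j+1.  No path
-- of 𝒫 shares an edge with q: it would contain x, hence be p, hence contain an
-- endpoint of q.  So the exchange loses nothing in either score and gains the
-- edge xw of p: the new packing lies in 𝔔₍₁₎ and has larger score₂ than 𝒬.
module Submission where

open import Defs
open import Data.Nat using (ℕ; suc; _+_; _≤_)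
open import Data.Nat.Properties using (module ≤-Reasoning; ≤-trans; ≤-reflexive; m≤m+n; m≤n+m; +-assoc; +-identityʳ; m<m+n; n≮n)
open import Data.Nat.Tactic.RingSolver using (solve-∀)
open import Data.Nat.ListAction using (sum)
open import Data.Bool using (Bool; true; false; T; _∨_)
open import Data.Bool.Properties using (T-∧; T-∨)
open import Data.Fin.Properties using (_≟_)
open import Data.List using (List; []; _∷_; length; map)
open import Data.List.Properties using (map-cong-local)
open import Data.List.Membership.Propositional using (_∈_; find; lose)
open import Data.List.Relation.Unary.Any using (here; there; any?)
open import Data.List.Relation.Unary.Any.Properties using (any⁺; any⁻)
open import Data.List.Relation.Unary.All as All using (All; []; _∷_)
open import Data.List.Relation.Unary.AllPairs using (AllPairs; []; _∷_)
open import Data.Product using (_×_; _,_; proj₁; proj₂; ∃-syntax)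
open import Data.Sum using (_⊎_; inj₁; inj₂)
open import Data.Empty using (⊥; ⊥-elim)
open import Function.Base using (case_of_)
open import Function.Bundles using (Equivalence)
open import Relation.Nullary using (¬_; Dec; yes; no)
open import Relation.Nullary.Decidable using (⌊_⌋; toWitness; fromWitness; map′; _⊎-dec_)
open import Relation.Binary.PropositionalEquality using (_≡_; refl; sym; trans; cong; cong₂; module ≡-Reasoning)
open Equivalence using (to; from)

swap-outer : ∀ a b c → a + b + c ≡ c + b + a
swap-outer = solve-∀

interchange : ∀ a b c d → a + b + (c + d) ≡ a + c + (b + d)
interchange = solve-∀

module _ {A : Set} where

  open ≡-Reasoning

  replace : ∀ {x} (xs : List A) → x ∈ xs → A → List A
  replace (_ ∷ ys) (here _)  z = z ∷ ys
  replace (y ∷ ys) (there i) z = y ∷ replace ys i z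

  length-replace : ∀ {x} (xs : List A) (i : x ∈ xs) z → length (replace xs i z) ≡ length xs
  length-replace (_ ∷ ys) (here _)  z = refl
  length-replace (y ∷ ys) (there i) z = cong suc (length-replace ys i z)

  sum-replace : ∀ {x} (g : A → ℕ) (xs : List A) (i : x ∈ xs) z →
                sum (map g (replace xs i z)) + g x ≡ sum (map g xs) + g z
  sum-replace g (x ∷ ys) (here refl) z = swap-outer (g z) (sum (map g ys)) (g x)
  sum-replace {x} g (y ∷ ys) (there i) z = begin
    g y + sum (map g (replace ys i z)) + g x   ≡⟨ +-assoc (g y) _ (g x) ⟩
    g y + (sum (map g (replace ys i z)) + g x) ≡⟨ cong (g y +_) (sum-replace g ys i z) ⟩
    g y + (sum (map g ys) + g z)               ≡⟨ +-assoc (g y) _ (g z) ⟨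
    g y + sum (map g ys) + g z                 ∎

  sum-≥ : ∀ {x} (g : A → ℕ) (xs : List A) → x ∈ xs → g x ≤ sum (map g xs)
  sum-≥ g (y ∷ ys) (here refl) = m≤m+n (g y) _
  sum-≥ g (y ∷ ys) (there i)   = ≤-trans (sum-≥ g ys i) (m≤n+m _ (g y))

  sum-map-+ : (g h : A → ℕ) (xs : List A) →
              sum (map (λ a → g a + h a) xs) ≡ sum (map g xs) + sum (map h xs)
  sum-map-+ g h []       = refl
  sum-map-+ g h (x ∷ xs) = begin
    g x + h x + sum (map (λ a → g a + h a) xs)    ≡⟨ cong (g x + h x +_) (sum-map-+ g h xs) ⟩
    g x + h x + (sum (map g xs) + sum (map h xs)) ≡⟨ interchange (g x) (h x) _ _ ⟩
    g x + sum (map g xs) + (h x + sum (map h xs)) ∎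

  All-replace : ∀ {P : A → Set} {x} (xs : List A) (i : x ∈ xs) {z} →
                All P xs → P z → All P (replace xs i z)
  All-replace (_ ∷ ys) (here _)  (_ ∷ pys)  pz = pz ∷ pys
  All-replace (y ∷ ys) (there i) (py ∷ pys) pz = py ∷ All-replace ys i pys pz

  AllPairs-replace : ∀ {R : A → A → Set} {x} (xs : List A) (i : x ∈ xs) {z} → AllPairs R xs →
                     (∀ {r} → r ∈ xs → R x r → R z r) → (∀ {r} → r ∈ xs → R r x → R r z) →
                     AllPairs R (replace xs i z)
  AllPairs-replace (_ ∷ ys) (here refl) (rs ∷ rss) toZ fromZ =
    All.tabulate (λ m → toZ (there m) (All.lookup rs m)) ∷ rss
  AllPairs-replace (y ∷ ys) (there i) (rs ∷ rss) toZ fromZ =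
    All-replace ys i rs (fromZ (here refl) (All.lookup rs i))
    ∷ AllPairs-replace ys i rss (λ m → toZ (there m)) (λ m → fromZ (there m))

  AllPairs-∈ : ∀ {R : A → A → Set} {xs : List A} {a b} → AllPairs R xs →
               a ∈ xs → b ∈ xs → a ≡ b ⊎ R a b ⊎ R b a
  AllPairs-∈ (rs ∷ rss) (here refl) (here refl) = inj₁ refl
  AllPairs-∈ (rs ∷ rss) (here refl) (there j)   = inj₂ (inj₁ (All.lookup rs j))
  AllPairs-∈ (rs ∷ rss) (there i)   (here refl) = inj₂ (inj₂ (All.lookup rs i))
  AllPairs-∈ (rs ∷ rss) (there i)   (there j)   = AllPairs-∈ rss i j

indicator-T : ∀ {b} → T b → indicator b ≡ 1
indicator-T {true} _ = refl

indicator-¬T : ∀ {b} → ¬ T b → indicator b ≡ 0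
indicator-¬T {true}  ¬t = ⊥-elim (¬t _)
indicator-¬T {false} _  = refl

-- |V(p) ∩ V(𝒬)| = 2 means exactly one of the three membership tests fails.
exactlyTwo : ∀ a b c → indicator a + (indicator b + (indicator c + 0)) ≡ 2 →
             (¬ T a × T b × T c) ⊎ (T a × ¬ T b × T c) ⊎ (T a × T b × ¬ T c)
exactlyTwo false true  true  _ = inj₁ ((λ ()) , _ , _)
exactlyTwo true  false true  _ = inj₂ (inj₁ (_ , (λ ()) , _))
exactlyTwo true  true  false _ = inj₂ (inj₂ (_ , _ , (λ ())))
exactlyTwo true  true  true  ()
exactlyTwo false false true  ()
exactlyTwo false true  false ()
exactlyTwo true  false false ()
exactlyTwo false false false ()

module _ {G : Graph} where

  ≟-sound : {a b : Vertex G} → T ⌊ a ≟ b ⌋ → a ≡ b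
  ≟-sound {a} {b} = toWitness {a? = a ≟ b}

  ≟-complete : {a b : Vertex G} → a ≡ b → T ⌊ a ≟ b ⌋
  ≟-complete {a} {b} = fromWitness {a? = a ≟ b}

  sameEdge-sound : {a b c d : Vertex G} → T (sameEdge {G} (a , b) (c , d)) →
                   (a ≡ c × b ≡ d) ⊎ (a ≡ d × b ≡ c)
  sameEdge-sound h with to T-∨ h
  ... | inj₁ h₁ = inj₁ (≟-sound (proj₁ (to T-∧ h₁)) , ≟-sound (proj₂ (to T-∧ h₁)))
  ... | inj₂ h₂ = inj₂ (≟-sound (proj₁ (to T-∧ h₂)) , ≟-sound (proj₂ (to T-∧ h₂)))

  sameEdge-refl : (a b : Vertex G) → T (sameEdge {G} (a , b) (a , b))
  sameEdge-refl a b = from T-∨ (inj₁ (from T-∧ (≟-complete {a} refl , ≟-complete {b} refl)))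

  sameEdge-swap : (a b : Vertex G) → T (sameEdge {G} (a , b) (b , a))
  sameEdge-swap a b = from T-∨ (inj₂ (from T-∧ (≟-complete {a} refl , ≟-complete {b} refl)))

  vertexTest : Vertex G → Triple G → Bool
  vertexTest v q = ⌊ v ≟ q1 q ⌋ ∨ ⌊ v ≟ q2 q ⌋ ∨ ⌊ v ≟ q3 q ⌋

  inVs?-sound : ∀ {v : Vertex G} Q → T (inVs? {G} v Q) → v ∈Vs Q
  inVs?-sound {v} Q h with find (any⁻ (vertexTest v) Q h)
  ... | q , q∈Q , hq with to T-∨ hq
  ...   | inj₁ h₁ = q , q∈Q , inj₁ (≟-sound h₁)
  ...   | inj₂ h₂ with to T-∨ h₂
  ...     | inj₁ h₃ = q , q∈Q , inj₂ (inj₁ (≟-sound h₃))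
  ...     | inj₂ h₃ = q , q∈Q , inj₂ (inj₂ (≟-sound h₃))

  inVs?-complete : ∀ {v : Vertex G} Q → v ∈Vs Q → T (inVs? {G} v Q)
  inVs?-complete {v} Q (q , q∈Q , v∈q) = any⁺ (vertexTest v) (lose q∈Q (test v∈q))
    where
    test : ∀ {q} → v ∈V q → T (vertexTest v q)
    test {q} (inj₁ e)        = from (T-∨ {⌊ v ≟ q1 q ⌋}) (inj₁ (≟-complete e))
    test {q} (inj₂ (inj₁ e)) = from (T-∨ {⌊ v ≟ q1 q ⌋}) (inj₂ (from (T-∨ {⌊ v ≟ q2 q ⌋}) (inj₁ (≟-complete e))))
    test {q} (inj₂ (inj₂ e)) = from (T-∨ {⌊ v ≟ q1 q ⌋}) (inj₂ (from (T-∨ {⌊ v ≟ q2 q ⌋}) (inj₂ (≟-complete e))))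

  endpoint? : (Q : List (Triple G)) (v : Vertex G) → Dec (IsEndpoint Q v)
  endpoint? Q v = map′ find (λ (q , q∈Q , e) → lose q∈Q e)
                       (any? (λ q → (v ≟ q1 q) ⊎-dec (v ≟ q3 q)) Q)

  endpoint⇒∈Vs : ∀ {Q : List (Triple G)} {v} → IsEndpoint Q v → v ∈Vs Q
  endpoint⇒∈Vs (q , q∈Q , inj₁ e) = q , q∈Q , inj₁ e
  endpoint⇒∈Vs (q , q∈Q , inj₂ e) = q , q∈Q , inj₂ (inj₂ e)

  centreOf : ∀ {Q : List (Triple G)} {v} → v ∈Vs Q → ¬ IsEndpoint Q v →
             ∃[ q ] (q ∈ Q × v ≡ q2 q)
  centreOf (q , q∈Q , inj₁ e)        ¬end = ⊥-elim (¬end (q , q∈Q , inj₁ e))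
  centreOf (q , q∈Q , inj₂ (inj₁ e)) ¬end = q , q∈Q , e
  centreOf (q , q∈Q , inj₂ (inj₂ e)) ¬end = ⊥-elim (¬end (q , q∈Q , inj₂ e))

  packing-shared : ∀ {P : List (Triple G)} {p p' v} → IsPacking G P →
                   p ∈ P → p' ∈ P → v ∈V p → v ∈V p' → p ≡ p'
  packing-shared (_ , disj) p∈P p'∈P vp vp' with AllPairs-∈ disj p∈P p'∈P
  ... | inj₁ p≡p'        = p≡p'
  ... | inj₂ (inj₁ d)    = ⊥-elim (d _ vp vp')
  ... | inj₂ (inj₂ d)    = ⊥-elim (d _ vp' vp)

  -- Shared edges.  An edge of q lies inside p only if p contains the centre of
  -- q together with one of its ends.

  EdgeInside : Triple G → Triple G → Set
  EdgeInside q p = q2 q ∈V p × ∃[ t ] ((t ≡ q1 q ⊎ t ≡ q3 q) × t ∈V p)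

  edgeIn-inside : ∀ {q p} {c d : Vertex G} → c ∈V p → d ∈V p →
                  T (edgeIn {G} (c , d) q) → EdgeInside q p
  edgeIn-inside {q} {c = c} {d} c∈p d∈p h with any⁻ (sameEdge {G} (c , d)) (edges q) h
  ... | here s with sameEdge-sound {c} {d} {q1 q} {q2 q} s
  ...   | inj₁ (refl , refl) = d∈p , _ , inj₁ refl , c∈p
  ...   | inj₂ (refl , refl) = c∈p , _ , inj₁ refl , d∈p
  edgeIn-inside {q} {c = c} {d} c∈p d∈p h | there (here s) with sameEdge-sound {c} {d} {q2 q} {q3 q} s
  ...   | inj₁ (refl , refl) = c∈p , _ , inj₂ refl , d∈p
  ...   | inj₂ (refl , refl) = d∈p , _ , inj₂ refl , c∈p

  commonEdges-zero : ∀ {p q : Triple G} → ¬ EdgeInside q p → commonEdges {G} p q ≡ 0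
  commonEdges-zero ¬in =
    cong₂ _+_ (indicator-¬T (λ h → ¬in (edgeIn-inside (inj₁ refl) (inj₂ (inj₁ refl)) h)))
              (cong (_+ 0) (indicator-¬T (λ h → ¬in (edgeIn-inside (inj₂ (inj₁ refl)) (inj₂ (inj₂ refl)) h))))

  sameEdgeSet-zero : ∀ {p q : Triple G} → ¬ EdgeInside q p → indicator (sameEdgeSet {G} p q) ≡ 0
  sameEdgeSet-zero ¬in = indicator-¬T λ h →
    ¬in (edgeIn-inside (inj₁ refl) (inj₂ (inj₁ refl)) (proj₁ (to T-∧ (proj₁ (to T-∧ h)))))

  data EdgeOf (p : Triple G) : Vertex G → Vertex G → Set where
    first   : EdgeOf p (q1 p) (q2 p)
    first⁻  : EdgeOf p (q2 p) (q1 p)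
    second  : EdgeOf p (q2 p) (q3 p)
    second⁻ : EdgeOf p (q3 p) (q2 p)

  EdgeOf-∈ : ∀ {p x w} → EdgeOf p x w → x ∈V p
  EdgeOf-∈ first   = inj₁ refl
  EdgeOf-∈ first⁻  = inj₂ (inj₁ refl)
  EdgeOf-∈ second  = inj₂ (inj₁ refl)
  EdgeOf-∈ second⁻ = inj₂ (inj₂ refl)

  EdgeOf-adj : ∀ {p x w} → IsP2 G p → EdgeOf p x w → Graph.Adj G x w
  EdgeOf-adj (_ , _ , _ , a₁₂ , a₂₃) first   = a₁₂
  EdgeOf-adj (_ , _ , _ , a₁₂ , a₂₃) first⁻  = Graph.sym G a₁₂
  EdgeOf-adj (_ , _ , _ , a₁₂ , a₂₃) second  = a₂₃
  EdgeOf-adj (_ , _ , _ , a₁₂ , a₂₃) second⁻ = Graph.sym G a₂₃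

  edgeOf-edges : ∀ {p x w} → EdgeOf p x w → ∃[ e ] (e ∈ edges {G} p × T (sameEdge {G} e (x , w)))
  edgeOf-edges {p} first   = _ , here refl         , sameEdge-refl (q1 p) (q2 p)
  edgeOf-edges {p} first⁻  = _ , here refl         , sameEdge-swap (q1 p) (q2 p)
  edgeOf-edges {p} second  = _ , there (here refl) , sameEdge-refl (q2 p) (q3 p)
  edgeOf-edges {p} second⁻ = _ , there (here refl) , sameEdge-swap (q2 p) (q3 p)

  EdgeOf-shared : ∀ {p x w} (a : Vertex G) → EdgeOf p x w → 1 ≤ commonEdges {G} p ⟨ a , x , w ⟩
  EdgeOf-shared {p} {x} {w} a xw with edgeOf-edges xw
  ... | e , e∈p , same =
    ≤-trans (≤-reflexive (sym (indicator-T
               (any⁺ {xs = edges {G} ⟨ a , x , w ⟩} (sameEdge {G} e) (there (here same))))))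
            (sum-≥ (λ e → indicator (edgeIn {G} e ⟨ a , x , w ⟩)) (edges p) e∈p)

  swing : Triple G → Vertex G → Triple G
  swing q w = ⟨ q1 q , q2 q , w ⟩

  swing-∈V : ∀ {q w v} → v ∈V swing q w → v ∈V q ⊎ v ≡ w
  swing-∈V (inj₁ e)        = inj₁ (inj₁ e)
  swing-∈V (inj₂ (inj₁ e)) = inj₁ (inj₂ (inj₁ e))
  swing-∈V (inj₂ (inj₂ e)) = inj₂ e

  swing-P2 : ∀ {q w} → IsP2 G q → ¬ (w ∈V q) → Graph.Adj G (q2 q) w → IsP2 G (swing q w)
  swing-P2 (q₁≢q₂ , _ , _ , a₁₂ , _) w∉q a₂w =
    q₁≢q₂ , (λ e → w∉q (inj₂ (inj₁ (sym e)))) , (λ e → w∉q (inj₁ (sym e))) , a₁₂ , a₂w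

  swing-packing : ∀ {Q : List (Triple G)} {q w} → IsPacking G Q → (i : q ∈ Q) →
                  ¬ (w ∈Vs Q) → Graph.Adj G (q2 q) w → IsPacking G (replace Q i (swing q w))
  swing-packing {Q} {q} {w} (P2s , disj) i w∉Q a₂w =
    All-replace Q i P2s (swing-P2 (All.lookup P2s i) (λ m → w∉Q (q , i , m)) a₂w) ,
    AllPairs-replace Q i disj
      (λ r∈Q d v vz vr → avoid r∈Q vr (swing-∈V vz) (λ vq → d v vq vr))
      (λ r∈Q d v vr vz → avoid r∈Q vr (swing-∈V vz) (d v vr))
    where
    avoid : ∀ {r v} → r ∈ Q → v ∈V r → v ∈V q ⊎ v ≡ w → ¬ (v ∈V q) → ⊥
    avoid r∈Q vr (inj₁ vq)  v∉q = v∉q vq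
    avoid r∈Q vr (inj₂ refl) _  = w∉Q (_ , r∈Q , vr)

  -- The scores of Defs are double sums Σ_{p∈𝒫} Σ_{q∈𝒬} f p q of a pair score f.
  totalScore : (Triple G → Triple G → ℕ) → List (Triple G) → List (Triple G) → ℕ
  totalScore f P Q = sum (map (λ p → sum (map (f p) Q)) P)

  totalScore-replace : ∀ (f : Triple G → Triple G → ℕ) P Q {q} (i : q ∈ Q) z →
                       (∀ {p} → p ∈ P → f p q ≡ 0) →
                       totalScore f P (replace Q i z) ≡ totalScore f P Q + sum (map (λ p → f p z) P)
  totalScore-replace f P Q {q} i z q-null = begin
    sum (map (λ p → sum (map (f p) (replace Q i z))) P) ≡⟨ cong sum (map-cong-local (All.tabulate row)) ⟩
    sum (map (λ p → sum (map (f p) Q) + f p z) P)       ≡⟨ sum-map-+ _ _ P ⟩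
    totalScore f P Q + sum (map (λ p → f p z) P)        ∎
    where
    open ≡-Reasoning
    row : ∀ {p} → p ∈ P → sum (map (f p) (replace Q i z)) ≡ sum (map (f p) Q) + f p z
    row {p} p∈P = begin
      sum (map (f p) (replace Q i z))         ≡⟨ +-identityʳ _ ⟨
      sum (map (f p) (replace Q i z)) + 0     ≡⟨ cong (sum (map (f p) (replace Q i z)) +_) (sym (q-null p∈P)) ⟩
      sum (map (f p) (replace Q i z)) + f p q ≡⟨ sum-replace (f p) Q i z ⟩
      sum (map (f p) Q) + f p z               ∎

  -- Swinging q onto w stays in 𝔔₍₁₎ and raises score₂.
  exchange : ∀ {P Q : List (Triple G)} {j p q w} → IsPacking G P → In𝔔₂ G P j Q →
             p ∈ P → (∀ {v} → v ∈V p → ¬ IsEndpoint Q v) →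
             q ∈ Q → EdgeOf p (q2 q) w → ¬ (w ∈Vs Q) → ⊥
  exchange {P} {Q} {j} {q = q} {w} packP ((packQ , lenQ , max₁) , max₂) p∈P noEnd q∈Q xw w∉Q =
    n≮n (score₂ P Q) (begin-strict
      score₂ P Q                          <⟨ m<m+n (score₂ P Q) gain ⟩
      score₂ P Q + shared₂                 ≡⟨ score₂-change ⟨
      score₂ P Q'                          ≤⟨ max₂ Q' Q'∈𝔔₁ ⟩
      score₂ P Q                           ∎)
    where
    open ≤-Reasoning
    z : Triple G
    z = swing q w
    Q' : List (Triple G)
    Q' = replace Q q∈Q z

    -- No path of 𝒫 contains an edge of q: it would contain the centre of q,
    -- hence be p, hence contain an endpoint of q.
    apart : ∀ {p'} → p' ∈ P → ¬ EdgeInside q p'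
    apart p'∈P (x∈p' , t , t-end , t∈p')
      with packing-shared packP p∈P p'∈P (EdgeOf-∈ xw) x∈p'
    ... | refl = noEnd t∈p' (q , q∈Q , t-end)

    score₁-change : score₁ P Q' ≡ score₁ P Q + sum (map (λ p' → indicator (sameEdgeSet {G} p' z)) P)
    score₁-change = totalScore-replace (λ p' r → indicator (sameEdgeSet {G} p' r)) P Q q∈Q z
                      (λ p'∈P → sameEdgeSet-zero (apart p'∈P))

    -- The exchange does not lower score₁, so 𝒬' stays in 𝔔₍₁₎.
    Q'∈𝔔₁ : In𝔔₁ G P j Q'
    Q'∈𝔔₁ = swing-packing packQ q∈Q w∉Q (EdgeOf-adj (All.lookup (proj₁ packP) p∈P) xw)
          , trans (length-replace Q q∈Q z) lenQ
          , λ Q'' packQ'' lenQ'' → ≤-trans (max₁ Q'' packQ'' lenQ'')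
                                     (≤-trans (m≤m+n _ _) (≤-reflexive (sym score₁-change)))

    shared₂ : ℕ
    shared₂ = sum (map (λ p' → commonEdges {G} p' z) P)

    score₂-change : score₂ P Q' ≡ score₂ P Q + shared₂
    score₂-change = totalScore-replace commonEdges P Q q∈Q z (λ p'∈P → commonEdges-zero (apart p'∈P))

    -- The edge xw of p is an edge of z.
    gain : 1 ≤ shared₂
    gain = ≤-trans (EdgeOf-shared (q1 q) xw) (sum-≥ (λ p' → commonEdges {G} p' z) P p∈P)

  noEndpoint-impossible : ∀ {P Q : List (Triple G)} {j p} → IsPacking G P → In𝔔₂ G P j Q →
                          p ∈ P → sharedVertices p Q ≡ 2 →
                          (∀ {v} → v ∈V p → ¬ IsEndpoint Q v) → ⊥
  noEndpoint-impossible {Q = Q} {p = p} packP Q∈𝔔₂ p∈P two noEnd =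
    case exactlyTwo (inVs? {G} (q1 p) Q) (inVs? {G} (q2 p) Q) (inVs? {G} (q3 p) Q) two of λ where
      (inj₁ (out₁ , in₂ , _))        → exchangeAlong first⁻ in₂ out₁
      (inj₂ (inj₁ (in₁ , out₂ , _))) → exchangeAlong first in₁ out₂
      (inj₂ (inj₂ (_ , in₂ , out₃))) → exchangeAlong second in₂ out₃
    where
    exchangeAlong : ∀ {x w} → EdgeOf p x w → T (inVs? {G} x Q) → ¬ T (inVs? {G} w Q) → ⊥
    exchangeAlong xw x∈Q w∉Q with centreOf (inVs?-sound Q x∈Q) (noEnd (EdgeOf-∈ xw))
    ... | q , q∈Q , refl = exchange packP Q∈𝔔₂ p∈P noEnd q∈Q xw (λ w∈Q → w∉Q (inVs?-complete Q w∈Q))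

corollary3 : (G : Graph) (j : ℕ) (P : List (Triple G))
    → IsMaximalPacking G P → length P ≡ j
    → (∃[ Q₀ ] (IsPacking G Q₀ × length Q₀ ≡ suc j))
    → (Q : List (Triple G)) → In𝔔₂ G P j Q
    → (p : Triple G) → p ∈ P → sharedVertices p Q ≡ 2
    → ∃[ v ] (v ∈V p × v ∈Vs Q × IsEndpoint Q v)
corollary3 G j P (packP , _) _ _ Q Q∈𝔔₂ p p∈P two
  with endpoint? Q (q1 p) | endpoint? Q (q2 p) | endpoint? Q (q3 p)
... | yes e | _     | _     = q1 p , inj₁ refl , endpoint⇒∈Vs e , e
... | no _  | yes e | _     = q2 p , inj₂ (inj₁ refl) , endpoint⇒∈Vs e , e
... | no _  | no _  | yes e = q3 p , inj₂ (inj₂ refl) , endpoint⇒∈Vs e , e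
... | no ¬e₁ | no ¬e₂ | no ¬e₃ = ⊥-elim (noEndpoint-impossible packP Q∈𝔔₂ p∈P two
      λ { (inj₁ refl) → ¬e₁ ; (inj₂ (inj₁ refl)) → ¬e₂ ; (inj₂ (inj₂ refl)) → ¬e₃ })
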